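{- Let $\ell\geq7$ and let $G$ be an $\ell$-monoholed graph. Let $S$ be a $4$-spider in $G$ with toes $t_1,\dots,t_4$ and body $A$, and write $d(i,j)=d_S(t_i,t_j)$. If $A$ has a cut-vertex, then two of the three numbers $d(1,2)+d(3,4)$, $d(1,3)+d(2,4)$, $d(1,4)+d(2,3)$ are equal and each is at least two more than the third.
   Context: A hole is an induced cycle of length at least four; $G$ is $\ell$-monoholed if every hole has length exactly $\ell$. For $k\geq3$, a $k$-spider is a connected graph $S$ whose vertices of degree one are exactly $t_1,\dots,t_k$ (toes), minimal in the sense that no proper induced subgraph of $S$ containing all toes is connected. A leg of $S$ is a path $P$ of $S$ with one end a toe that is maximal subject to all interior vertices of $P$ having degree two in $S$; the $t_i$-leg $L_i$ is the leg ending at $t_i$, and its other end $a_i$ is the $t_i$-joint. The body of $S$ is the graph obtained from $S$ by deleting $V(L_i)\setminus\{a_i\}$ for every $i$. $d_S$ is distance in $S$. -}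

module Defs where

open import Data.Nat using (ℕ; zero; suc; _+_; _≤_)
open import Data.Fin using (Fin; toℕ; _≟_)
open import Data.Bool using (Bool; true; false; _∧_; not; if_then_else_)
open import Data.List using (List; []; _∷_; _++_; allFin; map; concat)
open import Data.Nat.ListAction using (sum)
open import Data.Bool.ListAction using (any)
open import Data.List.Relation.Unary.All using (All)
open import Data.List.Relation.Unary.Linked using (Linked)
open import Data.List.Relation.Unary.Unique.Propositional using (Unique)
open import Data.Product using (Σ; ∃; _×_; _,_)
open import Data.Sum using (_⊎_)
open import Relation.Binary.PropositionalEquality using (_≡_)
open import Relation.Nullary using (¬_)
open import Relation.Nullary.Decidable using (⌊_⌋)
open import Function using (_⇔_)
open import Function.Definitions using (Injective)

record Graph : Set where
  field
    n      : ℕ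
    adj    : Fin n → Fin n → Bool
    sym    : ∀ u v → adj u v ≡ adj v u
    irrefl : ∀ v → adj v v ≡ false

Consec : (k : ℕ) → Fin k → Fin k → Set
Consec k i j = (suc (toℕ i) ≡ toℕ j) ⊎ (suc (toℕ i) ≡ k × toℕ j ≡ 0)

CycAdj : (k : ℕ) → Fin k → Fin k → Set
CycAdj k i j = Consec k i j ⊎ Consec k j i

dropLast : {A : Set} → List A → List A
dropLast []           = []
dropLast (x ∷ [])     = []
dropLast (x ∷ y ∷ ys) = x ∷ dropLast (y ∷ ys)

Interior : {A : Set} → List A → List A
Interior []       = []
Interior (x ∷ xs) = dropLast xs

module _ (G : Graph) where
  open Graph G

  VSet : Set
  VSet = Fin n → Bool

  IsHole : (k : ℕ) → (Fin k → Fin n) → Set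
  IsHole k c = (4 ≤ k) × Injective _≡_ _≡_ c
             × (∀ i j → (adj (c i) (c j) ≡ true) ⇔ CycAdj k i j)

  Monoholed : ℕ → Set
  Monoholed ℓ = ∀ k (c : Fin k → Fin n) → IsHole k c → k ≡ ℓ

  deg : VSet → Fin n → ℕ
  deg X v = sum (map (λ u → if X u ∧ adj v u then 1 else 0) (allFin n))

  data Walk (X : VSet) : Fin n → Fin n → ℕ → Set where
    here : ∀ {u} → X u ≡ true → Walk X u u 0
    step : ∀ {u w v k} → X u ≡ true → adj u w ≡ true → Walk X w v k → Walk X u v (suc k)

  Connected : VSet → Set
  Connected X = ∀ u v → X u ≡ true → X v ≡ true → ∃ λ k → Walk X u v k

  Dist : VSet → Fin n → Fin n → ℕ → Set
  Dist X u v d = Walk X u v d × (∀ m → Walk X u v m → d ≤ m)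

  _⊆_ : VSet → VSet → Set
  X ⊆ Y = ∀ v → X v ≡ true → Y v ≡ true

  IsSpider4 : VSet → (Fin 4 → Fin n) → Set
  IsSpider4 S t =
      Injective _≡_ _≡_ t
    × (∀ i → S (t i) ≡ true)
    × Connected S
    × (∀ v → S v ≡ true → (deg S v ≡ 1 ⇔ ∃ λ i → v ≡ t i))
    × (∀ X → X ⊆ S → (∀ i → X (t i) ≡ true) → Connected X → S ⊆ X)

  IsPathIn : VSet → List (Fin n) → Set
  IsPathIn X P = All (λ v → X v ≡ true) P × Unique P × Linked (λ a b → adj a b ≡ true) P

  LegPath : VSet → Fin n → List (Fin n) → Set
  LegPath S t rest = IsPathIn S (t ∷ rest) × All (λ v → deg S v ≡ 2) (Interior (t ∷ rest))

  IsLeg : VSet → Fin n → List (Fin n) → Set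
  IsLeg S t rest = LegPath S t rest
                 × (∀ rest' s → LegPath S t rest' → rest' ≡ rest ++ s → s ≡ [])

  -- body: delete V(L_i) ∖ {a_i} for every leg L_i = t i ∷ L i (a_i its last vertex)
  Body : VSet → (Fin 4 → Fin n) → (Fin 4 → List (Fin n)) → VSet
  Body S t L v = S v ∧ not (any (λ u → ⌊ u ≟ v ⌋)
                   (concat (map (λ i → dropLast (t i ∷ L i)) (allFin 4))))

  CutVertex : VSet → Fin n → Set
  CutVertex A v = A v ≡ true × ¬ Connected (λ u → A u ∧ not ⌊ u ≟ v ⌋)

-- Let v be a cut-vertex of the body A. Every component of S − v contains a toe, and not all toes
-- lie in one component: in either case a proper connected subset of S would contain all toes,
-- against the minimality of S. A toe alone in its component has that component inside its own
-- leg; then every vertex of A − v reaches one of the other toes, which all have partners and so,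
-- among only three toes, all lie in one component, and rerouting around the legs would make A − v
-- connected. Hence the toes form two pairs, each pair in its own component. Writing xᵢ = d(tᵢ, v),
-- toes in different components satisfy d(i, k) = xᵢ + xₖ, since every path between them meets v,
-- while within a pair d(i, j) < xᵢ + xⱼ: otherwise a geodesic through v would cover the component
-- of tᵢ and make v the joint of its leg. The conclusion is then arithmetic.

module Submission where

open import Defs
open import Data.Bool using (Bool; true; false; _∧_; _∨_; not; if_then_else_)
open import Data.Bool.Properties using (∧-conicalˡ; ∧-conicalʳ; ∧-zeroʳ; ∧-identityʳ; ∨-zeroʳ; not-injective; ¬-not)
  renaming (_≟_ to _≟ᵇ_)
open import Data.Bool.ListAction using (any)
open import Data.Empty using (⊥; ⊥-elim)
open import Data.Fin as Fin using (Fin; zero; suc; #_; _≟_)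
open import Data.Fin.Patterns using (0F; 1F; 2F; 3F)
open import Data.Fin.Properties using (pigeonhole; any?)
open import Data.List using (List; []; _∷_; _++_; length; map; concat; allFin; tabulate)
open import Data.List.Properties using (length-++; ++-assoc; ++-identityʳ; ++-conicalʳ; ∷-injectiveˡ; ∷-injectiveʳ)
open import Data.List.Membership.Propositional using (_∈_; _∉_)
open import Data.List.Membership.DecPropositional (_≟_ {4}) using (_∈?_)
open import Data.List.Membership.Propositional.Properties
  using (∈-∃++; ∈-++⁺ˡ; ∈-++⁺ʳ; ∈-++⁻; ∈-concat⁻; ∈-concat⁺′; ∈-map⁺; ∈-allFin)
open import Data.List.Relation.Unary.All as All using (All; []; _∷_; all?)
import Data.List.Relation.Unary.All.Properties as All
open import Data.List.Relation.Unary.AllPairs using ([]; _∷_)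
open import Data.List.Relation.Unary.Any using (here; there; satisfied)
open import Data.List.Relation.Unary.Any.Properties using (map⁻)
open import Data.List.Relation.Unary.Linked as Linked using (Linked; []; [-]; _∷_)
open import Data.List.Relation.Unary.Unique.Propositional using (Unique)
open import Data.List.Relation.Unary.Unique.Propositional.Properties using (Unique[x∷xs]⇒x∉xs)
open import Data.Nat as ℕ using (ℕ; zero; suc; _+_; _≤_; _<_; _≤?_; z≤n; s≤s)
open import Data.Nat.ListAction using (sum)
open import Data.Nat.Induction using (<-rec)
open import Data.Nat.Properties hiding (_≟_)
open import Algebra.Properties.CommutativeSemigroup +-commutativeSemigroup using (x∙yz≈y∙xz)
open import Data.Nat.Tactic.RingSolver using (solve-∀)
open import Data.Product using (∃; _×_; _,_; proj₁; proj₂)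
open import Data.Sum as Sum using (_⊎_; inj₁; inj₂; [_,_]′)
open import Effect.Monad using (RawMonad)
import Level
open import Function using (_∘_; id; case_of_; Equivalence)
open import Relation.Binary.PropositionalEquality
open import Relation.Nullary using (¬_; Dec; yes; no; ¬?)
open import Relation.Nullary.Decidable using (⌊_⌋; True; toWitness; _×-dec_; _⊎-dec_; decidable-stable; ¬¬-excluded-middle)
open import Relation.Nullary.Negation using (DoubleNegation; ¬¬-Monad)

indicator : Bool → ℕ
indicator b = if b then 1 else 0

sumFin : ∀ {n} → (Fin n → ℕ) → ℕ
sumFin {zero}  f = 0
sumFin {suc n} f = f zero + sumFin (f ∘ suc)

count : ∀ {n} → (Fin n → Bool) → ℕ
count g = sumFin (indicator ∘ g)

sum-map-tabulate : ∀ {n} {A : Set} (h : Fin n → A) (f : A → ℕ) →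
                   sum (map f (tabulate h)) ≡ sumFin (f ∘ h)
sum-map-tabulate {zero}  h f = refl
sum-map-tabulate {suc n} h f = cong (f (h zero) +_) (sum-map-tabulate (h ∘ suc) f)

sum-indicator≡count : ∀ {n} (g : Fin n → Bool) →
                      sum (map (λ u → if g u then 1 else 0) (allFin n)) ≡ count g
sum-indicator≡count g = sum-map-tabulate id (λ u → if g u then 1 else 0)

sumFin-cong : ∀ {n} {f h : Fin n → ℕ} → (∀ u → f u ≡ h u) → sumFin f ≡ sumFin h
sumFin-cong {zero}  e = refl
sumFin-cong {suc n} e = cong₂ _+_ (e zero) (sumFin-cong (e ∘ suc))

count-cong : ∀ {n} {g h : Fin n → Bool} → (∀ u → g u ≡ h u) → count g ≡ count h
count-cong e = sumFin-cong (cong indicator ∘ e)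

count-false : ∀ {n} {g : Fin n → Bool} → (∀ u → g u ≡ false) → count g ≡ 0
count-false {zero}  e = refl
count-false {suc n} {g} e rewrite e zero = count-false (e ∘ suc)

erase : ∀ {n} → (Fin n → Bool) → Fin n → Fin n → Bool
erase g a u = g u ∧ not ⌊ u ≟ a ⌋

erase-true : ∀ {n} (g : Fin n → Bool) {a b} → g b ≡ true → ¬ b ≡ a → erase g a b ≡ true
erase-true g {a} {b} gb b≢a with b ≟ a
... | yes b≡a = ⊥-elim (b≢a b≡a)
... | no _ rewrite gb = refl

erase-⊆ : ∀ {n} {g : Fin n → Bool} {a u} → erase g a u ≡ true → g u ≡ true
erase-⊆ = ∧-conicalˡ _ _

erase-≢ : ∀ {n} {g : Fin n → Bool} {a u} → erase g a u ≡ true → ¬ u ≡ a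
erase-≢ {g = g} {a} {u} e u≡a with u ≟ a | ∧-conicalʳ (g u) _ e
... | yes _ | ()
... | no u≢a | _ = u≢a u≡a

count-erase : ∀ {n} (g : Fin n → Bool) (a : Fin n) → count g ≡ indicator (g a) + count (erase g a)
count-erase {suc n} g zero =
  cong (indicator (g zero) +_)
       (sym (cong₂ _+_ (cong indicator (∧-zeroʳ (g zero))) (count-cong (λ u → ∧-identityʳ (g (suc u))))))
count-erase {suc n} g (suc a) = begin
  indicator (g zero) + count (g ∘ suc)
    ≡⟨ cong (indicator (g zero) +_) (count-erase (g ∘ suc) a) ⟩
  indicator (g zero) + (indicator (g (suc a)) + count (erase (g ∘ suc) a))
    ≡⟨ x∙yz≈y∙xz (indicator (g zero)) (indicator (g (suc a))) _ ⟩
  indicator (g (suc a)) + (indicator (g zero) + count (erase (g ∘ suc) a))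
    ≡⟨ cong₂ (λ c k → indicator (g (suc a)) + (indicator c + k))
             (sym (∧-identityʳ (g zero)))
             (count-cong (λ u → cong (λ b → g (suc u) ∧ not b) (sym (⌊suc≟suc⌋ u a)))) ⟩
  indicator (g (suc a)) + count (erase g (suc a))
  ∎
  where
  open ≡-Reasoning
  ⌊suc≟suc⌋ : ∀ {n} (u a : Fin n) → ⌊ suc u ≟ suc a ⌋ ≡ ⌊ u ≟ a ⌋
  ⌊suc≟suc⌋ u a with u ≟ a
  ... | yes refl = refl
  ... | no _     = refl

count-erase-true : ∀ {n} (g : Fin n → Bool) {a} → g a ≡ true → count g ≡ suc (count (erase g a))
count-erase-true g {a} ga = trans (count-erase g a) (cong (λ b → indicator b + count (erase g a)) ga)

count≥1 : ∀ {n} (g : Fin n → Bool) {a} → g a ≡ true → 1 ≤ count g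
count≥1 g ga rewrite count-erase-true g ga = s≤s z≤n

count≡1⇒unique : ∀ {n} (g : Fin n → Bool) {a b} → count g ≡ 1 → g a ≡ true → g b ≡ true → a ≡ b
count≡1⇒unique g {a} {b} c≡1 ga gb with b ≟ a
... | yes b≡a = sym b≡a
... | no  b≢a = ⊥-elim (1+n≰n (begin
      2                        ≤⟨ s≤s (count≥1 (erase g a) (erase-true g gb b≢a)) ⟩
      suc (count (erase g a))  ≡⟨ sym (count-erase-true g ga) ⟩
      count g                  ≡⟨ c≡1 ⟩
      1                        ∎))
  where open ≤-Reasoning

count≡2⇒either : ∀ {n} (g : Fin n → Bool) {a b c} → count g ≡ 2 → g a ≡ true → g b ≡ true → ¬ b ≡ a →
                 g c ≡ true → c ≡ a ⊎ c ≡ b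
count≡2⇒either g {a} {b} {c} c≡2 ga gb b≢a gc with c ≟ a | c ≟ b
... | yes c≡a | _       = inj₁ c≡a
... | no _    | yes c≡b = inj₂ c≡b
... | no c≢a  | no c≢b  = ⊥-elim (1+n≰n (begin
      3                                          ≤⟨ s≤s (s≤s (count≥1 (erase g′ b) gc′)) ⟩
      suc (suc (count (erase g′ b)))             ≡⟨ sym (cong suc (count-erase-true g′ gb′)) ⟩
      suc (count g′)                             ≡⟨ sym (count-erase-true g ga) ⟩
      count g                                    ≡⟨ c≡2 ⟩
      2                                          ∎))
  where
  open ≤-Reasoning
  g′ = erase g a
  gb′ = erase-true g gb b≢a
  gc′ = erase-true g′ (erase-true g gc c≢a) c≢b

two-true⇒count≡2 : ∀ {n} (g : Fin n → Bool) {a b} → g a ≡ true → g b ≡ true → ¬ b ≡ a →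
                   (∀ u → g u ≡ true → u ≡ a ⊎ u ≡ b) → count g ≡ 2
two-true⇒count≡2 g {a} {b} ga gb b≢a only = begin
  count g                          ≡⟨ count-erase-true g ga ⟩
  suc (count (erase g a))          ≡⟨ cong suc (count-erase-true (erase g a) (erase-true g gb b≢a)) ⟩
  suc (suc (count (erase (erase g a) b))) ≡⟨ cong (2 +_) (count-false none) ⟩
  2                                ∎
  where
  open ≡-Reasoning
  none : ∀ u → erase (erase g a) b u ≡ false
  none u with g u in gu | u ≟ a | u ≟ b
  ... | false | _       | _       = refl
  ... | true  | yes _   | _       = refl
  ... | true  | no _    | yes _   = refl
  ... | true  | no u≢a  | no u≢b  = ⊥-elim ([ u≢a , u≢b ]′ (only u gu))

count≡suc⇒witness : ∀ {n} (g : Fin n → Bool) {k} → count g ≡ suc k → ∃ λ a → g a ≡ true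
count≡suc⇒witness {zero}  g ()
count≡suc⇒witness {suc n} g c≡1+k with g zero in g0
... | true  = zero , g0
... | false = let a , ga = count≡suc⇒witness (g ∘ suc) c≡1+k in suc a , ga

Unique-tail : ∀ {A : Set} {x : A} {xs} → Unique (x ∷ xs) → Unique xs
Unique-tail (_ ∷ u) = u

Unique-++⁻ʳ : ∀ {A : Set} (xs : List A) {ys} → Unique (xs ++ ys) → Unique ys
Unique-++⁻ʳ []       u = u
Unique-++⁻ʳ (x ∷ xs) u = Unique-++⁻ʳ xs (Unique-tail u)

Unique-++⁻ˡ : ∀ {A : Set} (xs : List A) {ys} → Unique (xs ++ ys) → Unique xs
Unique-++⁻ˡ []       u       = []
Unique-++⁻ˡ (x ∷ xs) (x∉ ∷ u) = All.++⁻ˡ xs x∉ ∷ Unique-++⁻ˡ xs u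

Unique-++⇒∉ : ∀ {A : Set} (xs : List A) {ys x} → Unique (xs ++ ys) → x ∈ xs → x ∉ ys
Unique-++⇒∉ (y ∷ xs) u (here refl) x∈ys = Unique[x∷xs]⇒x∉xs u (∈-++⁺ʳ xs x∈ys)
Unique-++⇒∉ (y ∷ xs) u (there x∈xs) = Unique-++⇒∉ xs (Unique-tail u) x∈xs

Unique-flanks-distinct : ∀ {A : Set} (pre : List A) {a y b post} →
                         Unique (pre ++ a ∷ y ∷ b ∷ post) → ¬ b ≡ a
Unique-flanks-distinct pre u b≡a =
  Unique[x∷xs]⇒x∉xs (Unique-++⁻ʳ pre u) (there (here (sym b≡a)))

∈-middle : ∀ {A : Set} (pre : List A) {a rest} → a ∈ pre ++ a ∷ rest
∈-middle pre = ∈-++⁺ʳ pre (here refl)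

Linked-flanks : ∀ {A : Set} {R : A → A → Set} (pre : List A) {a y b post} →
                Linked R (pre ++ a ∷ y ∷ b ∷ post) → R a y × R y b
Linked-flanks []            (ray ∷ ryb ∷ _) = ray , ryb
Linked-flanks (x ∷ [])      (_ ∷ l)         = Linked-flanks [] l
Linked-flanks (x ∷ x′ ∷ pre) (_ ∷ l)        = Linked-flanks (x′ ∷ pre) l

lastOf : ∀ {A : Set} → A → List A → A
lastOf x []       = x
lastOf x (y ∷ ys) = lastOf y ys

lastOf∈ : ∀ {A : Set} (x : A) ys → lastOf x ys ∈ x ∷ ys
lastOf∈ x []       = here refl
lastOf∈ x (y ∷ ys) = there (lastOf∈ y ys)

∈⇒∈-dropLast⊎≡lastOf : ∀ {A : Set} {w : A} x ys → w ∈ x ∷ ys → w ∈ dropLast (x ∷ ys) ⊎ w ≡ lastOf x ys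
∈⇒∈-dropLast⊎≡lastOf x []       (here e)  = inj₂ e
∈⇒∈-dropLast⊎≡lastOf x (y ∷ ys) (here e)  = inj₁ (here e)
∈⇒∈-dropLast⊎≡lastOf x (y ∷ ys) (there m) with ∈⇒∈-dropLast⊎≡lastOf y ys m
... | inj₁ m′ = inj₁ (there m′)
... | inj₂ e  = inj₂ e

∈-dropLast⁻ : ∀ {A : Set} {w : A} xs → w ∈ dropLast xs → w ∈ xs
∈-dropLast⁻ (x ∷ y ∷ ys) (here e)  = here e
∈-dropLast⁻ (x ∷ y ∷ ys) (there m) = there (∈-dropLast⁻ (y ∷ ys) m)

∈-dropLast-∷ : ∀ {A : Set} {w : A} x xs → w ∈ dropLast xs → w ∈ dropLast (x ∷ xs)
∈-dropLast-∷ x (y ∷ ys) m = there m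

lastOf∉dropLast : ∀ {A : Set} (x : A) ys → Unique (x ∷ ys) → lastOf x ys ∉ dropLast (x ∷ ys)
lastOf∉dropLast x (y ∷ ys) u (here e)  = Unique[x∷xs]⇒x∉xs u (subst (_∈ y ∷ ys) e (lastOf∈ y ys))
lastOf∉dropLast x (y ∷ ys) u (there m) = lastOf∉dropLast y ys (Unique-tail u) m

lastOf∈dropLast-++ : ∀ {A : Set} (x : A) r y s → lastOf x r ∈ dropLast (x ∷ r ++ y ∷ s)
lastOf∈dropLast-++ x []      y s = here refl
lastOf∈dropLast-++ x (z ∷ r) y s = there (lastOf∈dropLast-++ z r y s)

∈-dropLast⇒flanked : ∀ {A : Set} {y : A} x xs → y ∈ dropLast xs →
                     ∃ λ pre → ∃ λ a → ∃ λ b → ∃ λ post → x ∷ xs ≡ pre ++ a ∷ y ∷ b ∷ post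
∈-dropLast⇒flanked x (w ∷ w′ ∷ ws) (here refl) = [] , x , w′ , ws , refl
∈-dropLast⇒flanked x (w ∷ w′ ∷ ws) (there m) =
  let pre , a , b , post , e = ∈-dropLast⇒flanked w (w′ ∷ ws) m in x ∷ pre , a , b , post , cong (x ∷_) e

any-≟⇒∈ : ∀ {m} {w : Fin m} xs → any (λ u → ⌊ u ≟ w ⌋) xs ≡ true → w ∈ xs
any-≟⇒∈ {w = w} (x ∷ xs) e with x ≟ w
... | yes refl = here refl
... | no _     = there (any-≟⇒∈ xs e)

∈⇒any-≟ : ∀ {m} {w : Fin m} {xs} → w ∈ xs → any (λ u → ⌊ u ≟ w ⌋) xs ≡ true
∈⇒any-≟ {w = w} (here refl) with w ≟ w
... | yes _ = refl
... | no w≢w = ⊥-elim (w≢w refl)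
∈⇒any-≟ {w = w} {x ∷ xs} (there m) with x ≟ w
... | yes _ = refl
... | no _  = ∈⇒any-≟ m

length-suffix< : ∀ {A : Set} (xs : List A) {y ys} → length ys < length (xs ++ y ∷ ys)
length-suffix< xs {y} {ys} = subst (length ys <_) (sym (length-++ xs)) (m≤n+m (suc (length ys)) (length xs))

length-++-<ʳ : ∀ {A : Set} (xs : List A) {ys zs} → length ys < length zs → length (xs ++ ys) < length (xs ++ zs)
length-++-<ʳ []       lt = lt
length-++-<ʳ (x ∷ xs) lt = s≤s (length-++-<ʳ xs lt)

-- Routes and geodesics

module _ (G : Graph) where
  open Graph G renaming (sym to adj-sym)

  adj⇒≢ : ∀ {x y} → adj x y ≡ true → ¬ x ≡ y
  adj⇒≢ {x} xy refl with trans (sym xy) (irrefl x)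
  ... | ()

  -- A walk in G[X] that records its vertices after the first.
  data Route (X : VSet G) : Fin n → Fin n → List (Fin n) → Set where
    [_]  : ∀ {u} → X u ≡ true → Route X u u []
    _∷⟨_⟩_ : ∀ {u w z r} → X u ≡ true → adj u w ≡ true → Route X w z r → Route X u z (w ∷ r)

  walk⇒route : ∀ {X u w k} → Walk G X u w k → ∃ λ r → Route X u w r × length r ≡ k
  walk⇒route (here x)     = [] , [ x ] , refl
  walk⇒route (step x a w) = let r , p , e = walk⇒route w in _ ∷ r , x ∷⟨ a ⟩ p , cong suc e

  route⇒walk : ∀ {X u w r} → Route X u w r → Walk G X u w (length r)
  route⇒walk [ x ]        = here x
  route⇒walk (x ∷⟨ a ⟩ p) = step x a (route⇒walk p)

  route-∈ : ∀ {X u z r} → Route X u z r → ∀ {y} → y ∈ u ∷ r → X y ≡ true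
  route-∈ [ x ]        (here refl) = x
  route-∈ (x ∷⟨ a ⟩ p) (here refl) = x
  route-∈ (x ∷⟨ a ⟩ p) (there m)   = route-∈ p m

  route-head : ∀ {X u z r} → Route X u z r → X u ≡ true
  route-head p = route-∈ p (here refl)

  route-last : ∀ {X u z r} → Route X u z r → X z ≡ true
  route-last [ x ]        = x
  route-last (x ∷⟨ a ⟩ p) = route-last p

  last∈route : ∀ {X u z r} → Route X u z r → z ∈ u ∷ r
  last∈route [ x ]        = here refl
  last∈route (x ∷⟨ a ⟩ p) = there (last∈route p)

  route-last≡lastOf : ∀ {X u z r} → Route X u z r → z ≡ lastOf u r
  route-last≡lastOf [ x ]        = refl
  route-last≡lastOf (x ∷⟨ a ⟩ p) = route-last≡lastOf p

  route-++ : ∀ {X u y z r₁ r₂} → Route X u y r₁ → Route X y z r₂ → Route X u z (r₁ ++ r₂)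
  route-++ [ x ]        q = q
  route-++ (x ∷⟨ a ⟩ p) q = x ∷⟨ a ⟩ route-++ p q

  route-split : ∀ {X u z} r₁ {y r₂} → Route X u z (r₁ ++ y ∷ r₂) →
                Route X u y (r₁ ++ y ∷ []) × Route X y z r₂
  route-split []       (x ∷⟨ a ⟩ p) = x ∷⟨ a ⟩ [ route-head p ] , p
  route-split (w ∷ r₁) (x ∷⟨ a ⟩ p) = let p₁ , p₂ = route-split r₁ p in x ∷⟨ a ⟩ p₁ , p₂

  route-suffix : ∀ {X u z r} → Route X u z r → ∀ {y} → y ∈ u ∷ r →
                 ∃ λ r′ → Route X y z r′ × (∀ {w} → w ∈ y ∷ r′ → w ∈ u ∷ r)
  route-suffix p            (here refl) = _ , p , id
  route-suffix (x ∷⟨ a ⟩ p) (there m)   = let r′ , q , ⊆ = route-suffix p m in r′ , q , there ∘ ⊆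

  route-snoc : ∀ {X u y z r} → Route X u y r → X z ≡ true → adj y z ≡ true → Route X u z (r ++ z ∷ [])
  route-snoc p xz a = route-++ p (route-last p ∷⟨ a ⟩ [ xz ])

  route-reverse : ∀ {X u z r} → Route X u z r → ∃ λ r′ → Route X z u r′ × length r′ ≡ length r
  route-reverse [ x ] = [] , [ x ] , refl
  route-reverse {u = u} (_∷⟨_⟩_ {w = w} x a p) =
    let r′ , q , e = route-reverse p in
    r′ ++ u ∷ [] , route-snoc q x (trans (adj-sym w u) a) ,
    trans (length-++ r′) (trans (+-comm (length r′) 1) (cong suc e))

  route-mono : ∀ {X Y u z r} → Route X u z r → (∀ {y} → y ∈ u ∷ r → Y y ≡ true) → Route Y u z r
  route-mono [ x ]        f = [ f (here refl) ]
  route-mono (x ∷⟨ a ⟩ p) f = f (here refl) ∷⟨ a ⟩ route-mono p (f ∘ there)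

  route-between : ∀ {X Y u z r y w} → Route X u z r → (∀ {x} → x ∈ u ∷ r → Y x ≡ true) →
                  y ∈ u ∷ r → w ∈ u ∷ r → ∃ λ r′ → Route Y y w r′
  route-between p ⊆Y y∈ w∈ =
    let r₁ , q₁ , ⊆₁ = route-suffix p y∈ ; r₂ , q₂ , ⊆₂ = route-suffix p w∈
        r₂′ , q₂′ , _ = route-reverse (route-mono q₂ (⊆Y ∘ ⊆₂))
    in _ , route-++ (route-mono q₁ (⊆Y ∘ ⊆₁)) q₂′

  route-linked : ∀ {X u z r} → Route X u z r → Linked (λ a b → adj a b ≡ true) (u ∷ r)
  route-linked [ x ]        = [-]
  route-linked (x ∷⟨ a ⟩ p) = a ∷ route-linked p

  route-all : ∀ {X u z r} → Route X u z r → All (λ y → X y ≡ true) (u ∷ r)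
  route-all [ x ]        = x ∷ []
  route-all (x ∷⟨ a ⟩ p) = x ∷ route-all p

  route-shortcut : ∀ {X u z r} (pre : List (Fin n)) {e mid f post} → Route X u z r →
                   u ∷ r ≡ pre ++ e ∷ mid ++ f ∷ post → adj e f ≡ true →
                   ∃ λ r′ → Route X u z r′ × u ∷ r′ ≡ pre ++ e ∷ f ∷ post
  route-shortcut [] {mid = mid} p refl ef = _ , route-head p ∷⟨ ef ⟩ proj₂ (route-split mid p) , refl
  route-shortcut (a ∷ pre) [ x ] eq ef with ++-conicalʳ pre _ (sym (∷-injectiveʳ eq))
  ... | ()
  route-shortcut (a ∷ pre) (x ∷⟨ uw ⟩ p) eq ef =
    let r′ , q , eq′ = route-shortcut pre p (∷-injectiveʳ eq) ef in
    _ , x ∷⟨ uw ⟩ q , cong₂ _∷_ (∷-injectiveˡ eq) eq′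

  Geodesic : VSet G → Fin n → Fin n → List (Fin n) → Set
  Geodesic X u z r = Route X u z r × (∀ r′ → Route X u z r′ → length r ≤ length r′)

  dist⇒geodesic : ∀ {X u w d} → Dist G X u w d → ∃ λ r → Geodesic X u w r × length r ≡ d
  dist⇒geodesic (wk , least) =
    let r , p , e = walk⇒route wk in
    r , (p , λ r′ p′ → subst (_≤ length r′) (sym e) (least _ (route⇒walk p′))) , e

  geodesic-tail : ∀ {X u w z r} → Geodesic X u z (w ∷ r) → Geodesic X w z r
  geodesic-tail (x ∷⟨ a ⟩ p , least) = p , λ r′ p′ → ≤-pred (least (_ ∷ r′) (x ∷⟨ a ⟩ p′))

  geodesic-unique : ∀ {X u z r} → Geodesic X u z r → Unique (u ∷ r)
  geodesic-unique {r = []}        g = [] ∷ []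
  geodesic-unique {u = u} {r = w ∷ r} g@(p , least) =
    All.¬Any⇒All¬ (w ∷ r) u∉ ∷ geodesic-unique (geodesic-tail g)
    where
    u∉ : u ∉ w ∷ r
    u∉ m with ∈-∃++ m
    ... | pre , post , e =
      <⇒≱ (subst (length post <_) (sym (cong length e)) (length-suffix< pre))
          (least post (proj₂ (route-split pre (subst (Route _ u _) e p))))

  geodesic-chord⇒consecutive : ∀ {X u z r} → Geodesic X u z r → ∀ pre {e rest f} →
                               u ∷ r ≡ pre ++ e ∷ rest → f ∈ rest → adj e f ≡ true →
                               ∃ λ rest′ → rest ≡ f ∷ rest′
  geodesic-chord⇒consecutive (p , least) pre eq f∈ ef with ∈-∃++ f∈
  ... | []     , post , refl = post , refl
  ... | c ∷ cs , post , refl =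
    let r′ , q , eq′ = route-shortcut pre {mid = c ∷ cs} {post = post} p eq ef in
    ⊥-elim (<⇒≱ (≤-pred (subst₂ _<_ (sym (cong length eq′)) (sym (cong length eq))
                                (length-++-<ʳ pre (s≤s (s≤s (length-suffix< cs))))))
                (least r′ q))

  geodesic-neighbour⇒flank : ∀ {X x z r} → Geodesic X x z r → ∀ pre {a y b post} →
                             x ∷ r ≡ pre ++ a ∷ y ∷ b ∷ post →
                             ∀ {u} → u ∈ x ∷ r → adj y u ≡ true → u ≡ a ⊎ u ≡ b
  geodesic-neighbour⇒flank g pre {a} {y} {b} {post} eq {u} u∈ yu with ∈-++⁻ pre (subst (u ∈_) eq u∈)
  ... | inj₂ (here refl)                 = inj₁ refl
  ... | inj₂ (there (here refl))         = ⊥-elim (adj⇒≢ yu refl)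
  ... | inj₂ (there (there (here refl))) = inj₂ refl
  ... | inj₂ (there (there (there u∈post)))
    with geodesic-chord⇒consecutive g (pre ++ a ∷ []) (trans eq (sym (++-assoc pre (a ∷ []) (y ∷ b ∷ post))))
                                    (there u∈post) yu
  ... | _ , refl = inj₂ refl
  geodesic-neighbour⇒flank g pre {a} {y} {b} {post} eq {u} u∈ yu | inj₁ u∈pre with ∈-∃++ u∈pre
  ... | ds , es , refl = ⊥-elim (y-twice es (proj₂ after-u) refl)
    where
    unique : Unique ((ds ++ u ∷ es) ++ a ∷ y ∷ b ∷ post)
    unique = subst Unique eq (geodesic-unique g)
    after-u = geodesic-chord⇒consecutive g ds (trans eq (++-assoc ds (u ∷ es) (a ∷ y ∷ b ∷ post)))
                                         (∈-++⁺ʳ es (there (here refl))) (trans (adj-sym u y) yu)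
    y-twice : ∀ es′ → es′ ++ a ∷ y ∷ b ∷ post ≡ y ∷ proj₁ after-u → es′ ≡ es → ⊥
    y-twice []         e refl = Unique[x∷xs]⇒x∉xs (Unique-++⁻ʳ (ds ++ u ∷ []) unique) (here (∷-injectiveˡ e))
    y-twice (e′ ∷ es″) e refl =
      Unique-++⇒∉ (ds ++ u ∷ e′ ∷ es″) unique (∈-++⁺ʳ ds (there (here (sym (∷-injectiveˡ e)))))
                  (there (here refl))

-- Degrees and legs

module _ (G : Graph) (S : VSet G) where
  open Graph G renaming (sym to adj-sym)

  private
    neighbourIn : Fin n → Fin n → Bool
    neighbourIn y u = S u ∧ adj y u

    deg≡count : ∀ y → deg G S y ≡ count (neighbourIn y)
    deg≡count y = sum-indicator≡count (neighbourIn y)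

  deg≡1⇒neighbour-unique : ∀ {y a b} → deg G S y ≡ 1 → S a ≡ true → adj y a ≡ true →
                           S b ≡ true → adj y b ≡ true → a ≡ b
  deg≡1⇒neighbour-unique {y} d sa ya sb yb =
    count≡1⇒unique (neighbourIn y) (trans (sym (deg≡count y)) d) (cong₂ _∧_ sa ya) (cong₂ _∧_ sb yb)

  deg≡2⇒neighbours : ∀ {y a b c} → deg G S y ≡ 2 → S a ≡ true → adj y a ≡ true →
                     S b ≡ true → adj y b ≡ true → ¬ b ≡ a → S c ≡ true → adj y c ≡ true → c ≡ a ⊎ c ≡ b
  deg≡2⇒neighbours {y} d sa ya sb yb b≢a sc yc =
    count≡2⇒either (neighbourIn y) (trans (sym (deg≡count y)) d)
                   (cong₂ _∧_ sa ya) (cong₂ _∧_ sb yb) b≢a (cong₂ _∧_ sc yc)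

  two-neighbours⇒deg≡2 : ∀ {y a b} → S a ≡ true → adj y a ≡ true → S b ≡ true → adj y b ≡ true → ¬ b ≡ a →
                         (∀ u → S u ≡ true → adj y u ≡ true → u ≡ a ⊎ u ≡ b) → deg G S y ≡ 2
  two-neighbours⇒deg≡2 {y} sa ya sb yb b≢a only =
    trans (deg≡count y)
          (two-true⇒count≡2 (neighbourIn y) (cong₂ _∧_ sa ya) (cong₂ _∧_ sb yb) b≢a
                            (λ u e → only u (∧-conicalˡ _ _ e) (∧-conicalʳ _ _ e)))

  deg≡suc⇒neighbour : ∀ {y k} → deg G S y ≡ suc k → ∃ λ w → S w ≡ true × adj y w ≡ true
  deg≡suc⇒neighbour {y} d =
    let w , e = count≡suc⇒witness (neighbourIn y) (trans (sym (deg≡count y)) d) in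
    w , ∧-conicalˡ _ _ e , ∧-conicalʳ _ _ e

  leg-nonempty : ∀ {t rest} → IsLeg G S t rest → deg G S t ≡ 1 → ¬ rest ≡ []
  leg-nonempty {t} ((((st ∷ _) , _) , _) , maximal) d refl with deg≡suc⇒neighbour d
  ... | w , sw , tw
    with maximal (w ∷ []) (w ∷ []) ((st ∷ sw ∷ [] , (adj⇒≢ G tw ∷ []) ∷ [] ∷ [] , tw ∷ [-]) , []) refl
  ... | ()

  legInterior-neighbour∈leg : ∀ {t rest} → LegPath G S t rest → deg G S t ≡ 1 →
                              ∀ {y w} → y ∈ dropLast (t ∷ rest) → S w ≡ true → adj y w ≡ true → w ∈ t ∷ rest
  legInterior-neighbour∈leg {t} {h ∷ hs} ((all , _ , th ∷ _) , _) d (here refl) sw tw =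
    there (here (deg≡1⇒neighbour-unique d sw tw (All.lookup all (there (here refl))) th))
  legInterior-neighbour∈leg {t} {h ∷ hs} ((all , unique , linked) , deg2) d {y} {w} (there y∈) sw yw
    with ∈-dropLast⇒flanked t (h ∷ hs) y∈
  ... | pre , a , b , post , e =
    [ (λ { refl → a∈ }) , (λ { refl → b∈ }) ]′
      (deg≡2⇒neighbours (All.lookup deg2 y∈) (S-at a∈) (trans (adj-sym y a) ay) (S-at b∈) yb
                        (Unique-flanks-distinct pre (subst Unique e unique)) sw yw)
    where
    ay = proj₁ (Linked-flanks pre (subst (Linked _) e linked))
    yb = proj₂ (Linked-flanks pre (subst (Linked _) e linked))
    a∈ : a ∈ t ∷ h ∷ hs
    a∈ = subst (a ∈_) (sym e) (∈-middle pre)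
    b∈ : b ∈ t ∷ h ∷ hs
    b∈ = subst (b ∈_) (sym e) (∈-++⁺ʳ pre (there (there (here refl))))
    S-at : ∀ {x} → x ∈ t ∷ h ∷ hs → S x ≡ true
    S-at = All.lookup all

  Prefix : List (Fin n) → List (Fin n) → Set
  Prefix xs ys = ∃ λ s → ys ≡ xs ++ s

  private
    path-tail : ∀ {x xs} → IsPathIn G S (x ∷ xs) → IsPathIn G S xs
    path-tail ((_ ∷ all) , (_ ∷ unique) , linked) = all , unique , Linked.tail linked

    path-head : ∀ {x xs} → IsPathIn G S (x ∷ xs) → S x ≡ true
    path-head ((sx ∷ _) , _) = sx

    path-adj : ∀ {x y xs} → IsPathIn G S (x ∷ y ∷ xs) → adj x y ≡ true
    path-adj (_ , _ , (xy ∷ _)) = xy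

    path-head∉ : ∀ {x xs} → IsPathIn G S (x ∷ xs) → x ∉ xs
    path-head∉ (_ , unique , _) = Unique[x∷xs]⇒x∉xs unique

    prefix-∷ : ∀ {y r₁ r₂} → Prefix r₁ r₂ ⊎ Prefix r₂ r₁ →
               Prefix (y ∷ r₁) (y ∷ r₂) ⊎ Prefix (y ∷ r₂) (y ∷ r₁)
    prefix-∷ (inj₁ (s , e)) = inj₁ (s , cong (_ ∷_) e)
    prefix-∷ (inj₂ (s , e)) = inj₂ (s , cong (_ ∷_) e)

  deg2-paths-comparable :
    ∀ p x r₁ r₂ → S p ≡ true → adj x p ≡ true → p ∉ r₁ → p ∉ r₂ →
    IsPathIn G S (x ∷ r₁) → IsPathIn G S (x ∷ r₂) →
    All (λ y → deg G S y ≡ 2) (dropLast (x ∷ r₁)) → All (λ y → deg G S y ≡ 2) (dropLast (x ∷ r₂)) →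
    Prefix r₁ r₂ ⊎ Prefix r₂ r₁
  deg2-paths-comparable p x []        r₂        _ _ _ _ _ _ _ _ = inj₁ (r₂ , refl)
  deg2-paths-comparable p x (y₁ ∷ r₁) []        _ _ _ _ _ _ _ _ = inj₂ (y₁ ∷ r₁ , refl)
  deg2-paths-comparable p x (y₁ ∷ r₁) (y₂ ∷ r₂) sp xp p∉₁ p∉₂ P₁ P₂ (dx ∷ d₁) (_ ∷ d₂)
    with deg≡2⇒neighbours dx sp xp (path-head (path-tail P₁)) (path-adj P₁) (λ e → p∉₁ (here (sym e)))
                          (path-head (path-tail P₂)) (path-adj P₂)
  ... | inj₁ y₂≡p = ⊥-elim (p∉₂ (here (sym y₂≡p)))
  ... | inj₂ refl =
    prefix-∷ (deg2-paths-comparable x y₁ r₁ r₂ (path-head P₁) (trans (adj-sym y₁ x) (path-adj P₁))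
                                    (path-head∉ P₁ ∘ there) (path-head∉ P₂ ∘ there)
                                    (path-tail P₁) (path-tail P₂) d₁ d₂)

  legPaths-comparable : ∀ {t r₁ r₂} → LegPath G S t r₁ → LegPath G S t r₂ → deg G S t ≡ 1 →
                        Prefix r₁ r₂ ⊎ Prefix r₂ r₁
  legPaths-comparable {t} {[]}      {r₂}      _ _ _ = inj₁ (r₂ , refl)
  legPaths-comparable {t} {y₁ ∷ r₁} {[]}      _ _ _ = inj₂ (y₁ ∷ r₁ , refl)
  legPaths-comparable {t} {y₁ ∷ r₁} {y₂ ∷ r₂} (P₁ , d₁) (P₂ , d₂) dt
    with deg≡1⇒neighbour-unique dt (path-head (path-tail P₁)) (path-adj P₁) (path-head (path-tail P₂)) (path-adj P₂)
  ... | refl =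
    prefix-∷ (deg2-paths-comparable t y₁ r₁ r₂ (path-head P₁) (trans (adj-sym y₁ t) (path-adj P₁))
                                    (path-head∉ P₁ ∘ there) (path-head∉ P₂ ∘ there)
                                    (path-tail P₁) (path-tail P₂) d₁ d₂)

  route-exits-leg-via-joint :
    ∀ {t rest} → LegPath G S t rest → deg G S t ≡ 1 →
    ∀ {X y z r} → (∀ u → X u ≡ true → S u ≡ true) → Route G X y z r →
    y ∈ dropLast (t ∷ rest) → z ∉ dropLast (t ∷ rest) →
    ∃ λ r′ → Route G X (lastOf t rest) z r′ × length r′ ≤ length r
  route-exits-leg-via-joint lp d X⊆S [ x ] y∈ z∉ = ⊥-elim (z∉ y∈)
  route-exits-leg-via-joint {t} {rest} lp d X⊆S (_∷⟨_⟩_ {w = w} x yw p) y∈ z∉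
    with ∈⇒∈-dropLast⊎≡lastOf t rest (legInterior-neighbour∈leg lp d y∈ (X⊆S w (route-head G p)) yw)
  ... | inj₁ w∈ = let r′ , q , le = route-exits-leg-via-joint lp d X⊆S p w∈ z∉ in r′ , q , m≤n⇒m≤1+n le
  ... | inj₂ refl = _ , p , n≤1+n _

-- Partitions of four elements

Enumerates : Fin 4 → Fin 4 → Fin 4 → Fin 4 → Set
Enumerates a b c d = ∀ j → j ≡ a ⊎ j ≡ b ⊎ j ≡ c ⊎ j ≡ d

enumerates : ∀ {a b c d} → {ok : True (all? (_∈? a ∷ b ∷ c ∷ d ∷ []) (allFin 4))} → Enumerates a b c d
enumerates {ok = ok} j with All.lookup (toWitness ok) (∈-allFin j)
... | here e                         = inj₁ e
... | there (here e)                 = inj₂ (inj₁ e)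
... | there (there (here e))         = inj₂ (inj₂ (inj₁ e))
... | there (there (there (here e))) = inj₂ (inj₂ (inj₂ e))

fin4-no-five-distinct : (a b c d e : Fin 4) → ¬ a ≡ b → ¬ a ≡ c → ¬ a ≡ d → ¬ a ≡ e →
                        ¬ b ≡ c → ¬ b ≡ d → ¬ b ≡ e → ¬ c ≡ d → ¬ c ≡ e → ¬ d ≡ e → ⊥
fin4-no-five-distinct a b c d e ab ac ad ae bc bd be cd ce de =
  let x , y , x<y , fx≡fy = pigeonhole (s≤s (s≤s (s≤s (s≤s (s≤s z≤n))))) f in distinct x<y fx≡fy
  where
  f : Fin 5 → Fin 4
  f zero                          = a
  f (suc zero)                    = b
  f (suc (suc zero))              = c
  f (suc (suc (suc zero)))        = d
  f (suc (suc (suc (suc zero))))  = e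
  distinct : ∀ {x y} → x Fin.< y → ¬ f x ≡ f y
  distinct {zero}                   {suc zero}                     _ = ab
  distinct {zero}                   {suc (suc zero)}               _ = ac
  distinct {zero}                   {suc (suc (suc zero))}         _ = ad
  distinct {zero}                   {suc (suc (suc (suc zero)))}   _ = ae
  distinct {suc zero}               {suc (suc zero)}               _ = bc
  distinct {suc zero}               {suc (suc (suc zero))}         _ = bd
  distinct {suc zero}               {suc (suc (suc (suc zero)))}   _ = be
  distinct {suc (suc zero)}         {suc (suc (suc zero))}         _ = cd
  distinct {suc (suc zero)}         {suc (suc (suc (suc zero)))}   _ = ce
  distinct {suc (suc (suc zero))}   {suc (suc (suc (suc zero)))}   _ = de
  distinct {suc zero}               {suc zero}                     (s≤s ())
  distinct {suc (suc zero)}         {suc zero}                     (s≤s ())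
  distinct {suc (suc zero)}         {suc (suc zero)}               (s≤s (s≤s ()))
  distinct {suc (suc (suc _))}      {suc zero}                     (s≤s ())
  distinct {suc (suc (suc _))}      {suc (suc zero)}               (s≤s (s≤s ()))
  distinct {suc (suc (suc zero))}   {suc (suc (suc zero))}         (s≤s (s≤s (s≤s ())))
  distinct {suc (suc (suc (suc _)))} {suc (suc (suc (suc zero)))}  (s≤s (s≤s (s≤s (s≤s ()))))

module PartialPartition (s : Fin 4 → Fin 4 → Bool)
  (s-sym : ∀ {i j} → s i j ≡ true → s j i ≡ true)
  (s-trans : ∀ {i j k} → s i j ≡ true → s j k ≡ true → s i k ≡ true) where

  Isolated : Fin 4 → Set
  Isolated i = ∀ k → s i k ≡ true → k ≡ i

  Partnered : Fin 4 → Set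
  Partnered i = ∃ λ j → ¬ j ≡ i × s i j ≡ true

  partnered⊎isolated : ∀ i → Partnered i ⊎ Isolated i
  partnered⊎isolated i with any? (λ j → ¬? (j ≟ i) ×-dec (s i j ≟ᵇ true))
  ... | yes (j , j≢i , sij) = inj₁ (j , j≢i , sij)
  ... | no ¬partner = inj₂ λ k sik → decidable-stable (k ≟ i) (λ k≢i → ¬partner (k , k≢i , sik))

  s-refl : ∀ {i j} → s i j ≡ true → s i i ≡ true
  s-refl sij = s-trans sij (s-sym sij)

  -- Beside an isolated element only three remain, so two pairs of partners must share an element.
  isolated⇒pairs-related : ∀ {i j j′ k k′} → Isolated i → ¬ j′ ≡ j → s j j′ ≡ true → ¬ k′ ≡ k → s k k′ ≡ true →
                            s j k ≡ true
  isolated⇒pairs-related {i} {j} {j′} {k} {k′} isolated j′≢j sjj′ k′≢k skk′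
    with k ≟ j | k ≟ j′ | k′ ≟ j | k′ ≟ j′
  ... | yes refl | _        | _        | _        = s-refl sjj′
  ... | no _     | yes refl | _        | _        = sjj′
  ... | no _     | no _     | yes refl | _        = s-sym skk′
  ... | no _     | no _     | no _     | yes refl = s-trans sjj′ (s-sym skk′)
  ... | no k≢j   | no k≢j′  | no k′≢j  | no k′≢j′ =
    ⊥-elim (fin4-no-five-distinct i j j′ k k′
      (≢i-left j′≢j sjj′ ∘ sym) (≢i-right j′≢j sjj′ ∘ sym) (≢i-left k′≢k skk′ ∘ sym) (≢i-right k′≢k skk′ ∘ sym)
      (j′≢j ∘ sym) (k≢j ∘ sym) (k′≢j ∘ sym) (k≢j′ ∘ sym) (k′≢j′ ∘ sym) (k′≢k ∘ sym))
    where
    ≢i-left : ∀ {x y} → ¬ y ≡ x → s x y ≡ true → ¬ x ≡ i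
    ≢i-left y≢x sxy refl = y≢x (isolated _ sxy)
    ≢i-right : ∀ {x y} → ¬ y ≡ x → s x y ≡ true → ¬ y ≡ i
    ≢i-right y≢x sxy refl = y≢x (sym (isolated _ (s-sym sxy)))

  two-classes : ∀ a b c d → Enumerates a b c d → ¬ (∀ j → s a j ≡ true) → (∀ i → Partnered i) → s a b ≡ true →
                s c d ≡ true × s a c ≡ false × s a d ≡ false × s b c ≡ false × s b d ≡ false
  two-classes a b c d enum a-not-universal partnered sab =
    cd , ¬-not ¬ac , ¬-not ¬ad , ¬-not (¬ac ∘ s-trans sab) , ¬-not (¬ad ∘ s-trans sab)
    where
    related-to-a : ∀ {x y} → Enumerates a b x y → s a x ≡ true → s a y ≡ true
    related-to-a {x} {y} enum′ sax with partnered y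
    ... | e , e≢y , sye with enum′ e
    ...   | inj₁ refl                 = s-sym sye
    ...   | inj₂ (inj₁ refl)          = s-trans sab (s-sym sye)
    ...   | inj₂ (inj₂ (inj₁ refl))   = s-trans sax (s-sym sye)
    ...   | inj₂ (inj₂ (inj₂ refl))   = ⊥-elim (e≢y refl)
    universal : s a c ≡ true → s a d ≡ true → ∀ j → s a j ≡ true
    universal sac sad j with enum j
    ... | inj₁ refl               = s-refl sab
    ... | inj₂ (inj₁ refl)        = sab
    ... | inj₂ (inj₂ (inj₁ refl)) = sac
    ... | inj₂ (inj₂ (inj₂ refl)) = sad
    swap-cd : Enumerates a b d c
    swap-cd j = Sum.map₂ (Sum.map₂ Sum.swap) (enum j)
    ¬ac : ¬ s a c ≡ true
    ¬ac sac = a-not-universal (universal sac (related-to-a enum sac))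
    ¬ad : ¬ s a d ≡ true
    ¬ad sad = a-not-universal (universal (related-to-a swap-cd sad) sad)
    cd : s c d ≡ true
    cd with partnered c
    ... | e , e≢c , sce with enum e
    ...   | inj₁ refl               = ⊥-elim (¬ac (s-sym sce))
    ...   | inj₂ (inj₁ refl)        = ⊥-elim (¬ac (s-trans sab (s-sym sce)))
    ...   | inj₂ (inj₂ (inj₁ refl)) = ⊥-elim (e≢c refl)
    ...   | inj₂ (inj₂ (inj₂ refl)) = sce

  class-of-pair : ∀ {i j c e} → Enumerates i j c e → s i c ≡ false → s i e ≡ false →
                  ∀ k → s i k ≡ true → k ≡ i ⊎ k ≡ j
  class-of-pair enum sic sie k sik with enum k
  ... | inj₁ k≡i               = inj₁ k≡i
  ... | inj₂ (inj₁ k≡j)        = inj₂ k≡j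
  ... | inj₂ (inj₂ (inj₁ refl)) with () ← trans (sym sik) sic
  ... | inj₂ (inj₂ (inj₂ refl)) with () ← trans (sym sik) sie

open RawMonad (¬¬-Monad {Level.zero})

¬¬-Π-Fin : ∀ {n} {P : Fin n → Set} → (∀ i → DoubleNegation (P i)) → DoubleNegation (∀ i → P i)
¬¬-Π-Fin {zero}  f = return λ ()
¬¬-Π-Fin {suc n} {P} f = f zero >>= λ p₀ → ¬¬-Π-Fin (f ∘ suc) >>= λ ps →
  return λ { zero → p₀ ; (suc i) → ps i }

Least : (ℕ → Set) → Set
Least P = ∃ λ k → P k × (∀ j → P j → k ≤ j)

¬¬-least : (P : ℕ → Set) → ∀ m → P m → DoubleNegation (Least P)
¬¬-least P = <-rec (λ m → P m → DoubleNegation (Least P)) λ m smaller pm →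
  ¬¬-excluded-middle {A = ∃ λ j → j < m × P j} >>= λ
  { (yes (j , j<m , pj)) → smaller j<m pj
  ; (no none)            → return (m , pm , λ j pj → ≮⇒≥ (λ j<m → none (j , j<m , pj))) }

FourPointSplit : (Fin 4 → Fin 4 → ℕ) → Set
FourPointSplit d =
    ((d (# 0) (# 1) + d (# 2) (# 3) ≡ d (# 0) (# 2) + d (# 1) (# 3))
     × (d (# 0) (# 3) + d (# 1) (# 2) + 2 ≤ d (# 0) (# 1) + d (# 2) (# 3)))
  ⊎ ((d (# 0) (# 1) + d (# 2) (# 3) ≡ d (# 0) (# 3) + d (# 1) (# 2))
     × (d (# 0) (# 2) + d (# 1) (# 3) + 2 ≤ d (# 0) (# 1) + d (# 2) (# 3)))
  ⊎ ((d (# 0) (# 2) + d (# 1) (# 3) ≡ d (# 0) (# 3) + d (# 1) (# 2))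
     × (d (# 0) (# 1) + d (# 2) (# 3) + 2 ≤ d (# 0) (# 2) + d (# 1) (# 3)))

fourPointSplit? : ∀ d → Dec (FourPointSplit d)
fourPointSplit? d = condition? _ _ _ ⊎-dec condition? _ _ _ ⊎-dec condition? _ _ _
  where
  condition? : ∀ m n k → Dec ((m ≡ n) × (k + 2 ≤ m))
  condition? m n k = (m ℕ.≟ n) ×-dec (k + 2 ≤? m)

-- a, b and c, e are the pairs joined inside a component of S − v; the cross pairs are separated by v.
pairs-through-cut-vertex :
  ∀ {dab dce dac dbe dae dbc} xa xb xc xe → suc dab ≤ xa + xb → suc dce ≤ xc + xe →
  dac ≡ xa + xc → dbe ≡ xb + xe → dae ≡ xa + xe → dbc ≡ xb + xc →
  (dac + dbe ≡ dae + dbc) × (dab + dce + 2 ≤ dac + dbe)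
pairs-through-cut-vertex {dab} {dce} xa xb xc xe ab ce refl refl refl refl =
  exchange xa xb xc xe ,
  subst₂ _≤_ (two-sucs dab dce) (regroup xa xb xc xe) (+-mono-≤ ab ce)
  where
  exchange : ∀ a b c e → (a + c) + (b + e) ≡ (a + e) + (b + c)
  exchange = solve-∀
  two-sucs : ∀ p q → suc p + suc q ≡ p + q + 2
  two-sucs = solve-∀
  regroup : ∀ a b c e → (a + b) + (c + e) ≡ (a + c) + (b + e)
  regroup = solve-∀

-- The spider cut at a body vertex

module Spider (G : Graph) (S : VSet G) (t : Fin 4 → Fin (Graph.n G)) (spider : IsSpider4 G S t)
              (L : Fin 4 → List (Fin (Graph.n G))) (legs : ∀ i → IsLeg G S (t i) (L i)) where
  open Graph G renaming (sym to adj-sym)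

  toe-injective : ∀ {i j} → t i ≡ t j → i ≡ j
  toe-injective = proj₁ spider

  toe∈S : ∀ i → S (t i) ≡ true
  toe∈S = proj₁ (proj₂ spider)

  S-connected : Connected G S
  S-connected = proj₁ (proj₂ (proj₂ spider))

  S-minimal : ∀ X → _⊆_ G X S → (∀ i → X (t i) ≡ true) → Connected G X → _⊆_ G S X
  S-minimal = proj₂ (proj₂ (proj₂ (proj₂ spider)))

  toe-deg≡1 : ∀ i → deg G S (t i) ≡ 1
  toe-deg≡1 i = Equivalence.from (proj₁ (proj₂ (proj₂ (proj₂ spider))) (t i) (toe∈S i)) (i , refl)

  legPath : ∀ i → LegPath G S (t i) (L i)
  legPath i = proj₁ (legs i)

  -- V(Lᵢ) ∖ {aᵢ}: the part of the i-th leg that Body deletes.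
  legOff : Fin 4 → List (Fin n)
  legOff i = dropLast (t i ∷ L i)

  joint : Fin 4 → Fin n
  joint i = lastOf (t i) (L i)

  A : VSet G
  A = Body G S t L

  toe∈legOff : ∀ i → t i ∈ legOff i
  toe∈legOff i with L i | leg-nonempty G S (legs i) (toe-deg≡1 i)
  ... | []    | nonempty = ⊥-elim (nonempty refl)
  ... | _ ∷ _ | _        = here refl

  toe∉legOff : ∀ {i j} → ¬ i ≡ j → t j ∉ legOff i
  toe∉legOff {i} {j} i≢j with L i | legPath i | leg-nonempty G S (legs i) (toe-deg≡1 i)
  ... | []    | _                 | nonempty = ⊥-elim (nonempty refl)
  ... | _ ∷ _ | (_ , interiorDeg2) | _ = λ
    { (here tj≡ti) → i≢j (toe-injective (sym tj≡ti))
    ; (there tj∈)  → 1≢2 (trans (sym (toe-deg≡1 j)) (All.lookup interiorDeg2 tj∈)) }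
    where
    1≢2 : ¬ 1 ≡ 2
    1≢2 ()

  body⊆S : ∀ {w} → A w ≡ true → S w ≡ true
  body⊆S = ∧-conicalˡ _ _

  body∉legOff : ∀ {w} → A w ≡ true → ∀ i → w ∉ legOff i
  body∉legOff {w} e i w∈ with trans (sym (∈⇒any-≟ (∈-concat⁺′ w∈ (∈-map⁺ legOff (∈-allFin i)))))
                                    (not-injective (∧-conicalʳ (S w) _ e))
  ... | ()

  S∖body⇒legOff : ∀ {w} → S w ≡ true → A w ≡ false → ∃ λ i → w ∈ legOff i
  S∖body⇒legOff {w} sw e rewrite sw =
    satisfied (map⁻ (∈-concat⁻ (map legOff (allFin 4))
                               (any-≟⇒∈ (concat (map legOff (allFin 4))) (not-injective e))))

  route-in-S : ∀ {y w} → S y ≡ true → S w ≡ true → ∃ λ r → Route G S y w r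
  route-in-S {y} {w} sy sw = let k , wk = S-connected y w sy sw ; r , p , _ = walk⇒route G wk in r , p

  connected-via : ∀ {X} c → (∀ y → X y ≡ true → ∃ λ r → Route G X y c r) → Connected G X
  connected-via c to-c u w xu xw =
    let r₁ , p₁ = to-c u xu ; r₂ , p₂ = to-c w xw ; r₂′ , p₂′ , _ = route-reverse G p₂ in
    _ , route⇒walk G (route-++ G p₁ p₂′)

  legPath-to-body≡leg : ∀ i {r} → LegPath G S (t i) r → A (lastOf (t i) r) ≡ true → L i ≡ r
  legPath-to-body≡leg i {r} lp end∈A with legPaths-comparable G S (legPath i) lp (toe-deg≡1 i)
  ... | inj₁ (s , e)     = sym (trans e (trans (cong (L i ++_) (proj₂ (legs i) r s lp e)) (++-identityʳ (L i))))
  ... | inj₂ ([] , e)    = trans e (++-identityʳ r)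
  ... | inj₂ (x ∷ s , e) =
    ⊥-elim (body∉legOff end∈A i (subst (λ l → lastOf (t i) r ∈ dropLast (t i ∷ l)) (sym e)
                                       (lastOf∈dropLast-++ (t i) r x s)))

  module CutAt (v : Fin n) (v∈A : A v ≡ true) where

    R : VSet G
    R = erase S v

    R⊆S : ∀ {u} → R u ≡ true → S u ≡ true
    R⊆S = erase-⊆ {g = S}

    Reach : Fin n → Fin n → Set
    Reach u w = ∃ λ r → Route G R u w r

    reach-refl : ∀ {u} → R u ≡ true → Reach u u
    reach-refl x = [] , [ x ]

    reach-sym : ∀ {u w} → Reach u w → Reach w u
    reach-sym (r , p) = let r′ , p′ , _ = route-reverse G p in r′ , p′

    reach-trans : ∀ {u w z} → Reach u w → Reach w z → Reach u z
    reach-trans (r₁ , p₁) (r₂ , p₂) = _ , route-++ G p₁ p₂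

    reach-snoc : ∀ {u y z} → Reach u y → R z ≡ true → adj y z ≡ true → Reach u z
    reach-snoc (r , p) rz yz = _ , route-snoc G p rz yz

    inList : List (Fin n) → VSet G
    inList W y = any (λ u → ⌊ u ≟ y ⌋) W

    route-avoids⊎meets-v : ∀ {u w r} → Route G S u w r →
                           Route G R u w r ⊎ (∃ λ r₁ → ∃ λ r₂ → Route G S u v r₁ × Route G S v w r₂ ×
                                                               length r₁ + length r₂ ≡ length r)
    route-avoids⊎meets-v {u} p with u ≟ v
    route-avoids⊎meets-v {u} p            | yes refl = inj₂ ([] , _ , [ route-head G p ] , p , refl)
    route-avoids⊎meets-v {u} [ su ]       | no u≢v   = inj₁ [ erase-true S su u≢v ]
    route-avoids⊎meets-v {u} (su ∷⟨ uw ⟩ p) | no u≢v with route-avoids⊎meets-v p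
    ... | inj₁ q                        = inj₁ (erase-true S su u≢v ∷⟨ uw ⟩ q)
    ... | inj₂ (r₁ , r₂ , q₁ , q₂ , e) = inj₂ (_ ∷ r₁ , r₂ , su ∷⟨ uw ⟩ q₁ , q₂ , cong suc e)

    A′ : VSet G
    A′ = erase A v

    -- A route of S − v between body vertices that enters a leg must leave it through the joint it
    -- came in by, so that excursion can be cut out; the fuel bounds the length of the route.
    reroute-in-body : ∀ fuel {p q r} → length r ≤ fuel → A p ≡ true → A q ≡ true → Route G R p q r →
                      ∃ λ r′ → Route G A′ p q r′
    reroute-in-body fuel       _  ap aq [ rp ] = [] , [ erase-true A ap (erase-≢ {g = S} rp) ]
    reroute-in-body (suc fuel) {p} le ap aq (_∷⟨_⟩_ {w = w} rp pw route) with A w in aw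
    ... | true  = let r′ , q′ = reroute-in-body fuel (≤-pred le) aw aq route in
                  _ , erase-true A ap (erase-≢ {g = S} rp) ∷⟨ pw ⟩ q′
    ... | false with S∖body⇒legOff (R⊆S (route-head G route)) aw
    ... | k , w∈leg with route-exits-leg-via-joint G S (legPath k) (toe-deg≡1 k) (λ _ → R⊆S) route w∈leg
                                                   (body∉legOff aq k)
    ... | r′ , q′ , shorter
      with ∈⇒∈-dropLast⊎≡lastOf (t k) (L k)
             (legInterior-neighbour∈leg G S (legPath k) (toe-deg≡1 k) w∈leg (body⊆S ap) (trans (adj-sym w p) pw))
    ... | inj₁ p∈leg = ⊥-elim (body∉legOff ap k p∈leg)
    ... | inj₂ refl  = reroute-in-body fuel (≤-trans shorter (≤-pred le)) ap aq q′

    module Components (reach? : ∀ u w → Dec (Reach u w)) where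

      component : Fin n → VSet G
      component u y = ⌊ reach? u y ⌋

      component⇒reach : ∀ {u y} → component u y ≡ true → Reach u y
      component⇒reach {u} {y} e with reach? u y
      ... | yes p = p

      reach⇒component : ∀ {u y} → Reach u y → component u y ≡ true
      reach⇒component {u} {y} p with reach? u y
      ... | yes _ = refl
      ... | no ¬p = ⊥-elim (¬p p)

      component⊆R : ∀ {u y} → component u y ≡ true → R y ≡ true
      component⊆R e = route-last G (proj₂ (component⇒reach e))

      component-step : ∀ {u y z} → component u y ≡ true → R z ≡ true → adj y z ≡ true → component u z ≡ true
      component-step e rz yz = reach⇒component (reach-snoc (component⇒reach e) rz yz)

      route-in-component : ∀ {u y z r} → component u y ≡ true → Route G R y z r →
                           ∀ {w} → w ∈ y ∷ r → component u w ≡ true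
      route-in-component e p            (here refl) = e
      route-in-component e (x ∷⟨ a ⟩ p) (there w∈)  = route-in-component (component-step e (route-head G p) a) p w∈

      route-to-v-outside : ∀ {Y} c → Y v ≡ true → (∀ {y} → S y ≡ true → component c y ≡ false → Y y ≡ true) →
                           ∀ {y r} → S y ≡ true → component c y ≡ false → Route G S y v r →
                           ∃ λ r′ → Route G Y y v r′
      route-to-v-outside c Yv outside⊆Y {y} sy cy p with y ≟ v
      ... | yes refl = [] , [ Yv ]
      route-to-v-outside c Yv outside⊆Y {y} sy cy [ _ ] | no y≢v = ⊥-elim (y≢v refl)
      route-to-v-outside c Yv outside⊆Y {y} sy cy (_∷⟨_⟩_ {w = w} _ yw p) | no y≢v with component c w in cw
      ... | true  with () ← trans (sym cy) (component-step cw (erase-true S sy y≢v) (trans (adj-sym w y) yw))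
      ... | false = let r′ , q = route-to-v-outside c Yv outside⊆Y (route-head G p) cw p in
                    _ , outside⊆Y sy cy ∷⟨ yw ⟩ q

      -- Removing the component of c, except the part inside W, leaves a connected set (through v)
      -- that still contains all toes; minimality of S forces the component into W.
      component⊆ : ∀ c (W : List (Fin n)) → (∀ {y} → y ∈ W → S y ≡ true) → v ∈ W →
                   (∀ {y} → y ∈ W → ∃ λ r → Route G (inList W) y v r) →
                   (∀ j → t j ∈ W ⊎ component c (t j) ≡ false) →
                   ∀ {y} → component c y ≡ true → y ∈ W
      component⊆ c W W⊆S v∈W to-v toes {y} cy =
        X⇒W (S-minimal X X⊆S toes∈X X-connected y (R⊆S (component⊆R cy)))
        where
        X : VSet G
        X y = inList W y ∨ (S y ∧ not (component c y))
        ∨-introʳ : ∀ {a b} → b ≡ true → a ∨ b ≡ true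
        ∨-introʳ {a} b≡true = trans (cong (a ∨_) b≡true) (∨-zeroʳ a)
        W⊆X : ∀ {y} → y ∈ W → X y ≡ true
        W⊆X y∈ = cong (_∨ _) (∈⇒any-≟ y∈)
        outside⊆X : ∀ {y} → S y ≡ true → component c y ≡ false → X y ≡ true
        outside⊆X sy cy = ∨-introʳ (cong₂ _∧_ sy (cong not cy))
        X⊆S : ∀ y → X y ≡ true → S y ≡ true
        X⊆S y e with inList W y in iy
        ... | true  = W⊆S (any-≟⇒∈ W iy)
        ... | false = ∧-conicalˡ _ _ e
        toes∈X : ∀ j → X (t j) ≡ true
        toes∈X j = [ W⊆X , outside⊆X (toe∈S j) ]′ (toes j)
        X-connected : Connected G X
        X-connected = connected-via v to-v′
          where
          to-v′ : ∀ y → X y ≡ true → ∃ λ r → Route G X y v r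
          to-v′ y e with inList W y in iy
          ... | true  = let r , p = to-v (any-≟⇒∈ W iy) in
                        r , route-mono G p (λ m → W⊆X (any-≟⇒∈ W (route-∈ G p m)))
          ... | false = let sy = ∧-conicalˡ (S y) _ e in
                        route-to-v-outside c (W⊆X v∈W) outside⊆X sy
                                           (not-injective (∧-conicalʳ (S y) _ e)) (proj₂ (route-in-S sy (body⊆S v∈A)))
        X⇒W : X y ≡ true → y ∈ W
        X⇒W e with inList W y in iy
        ... | true = any-≟⇒∈ W iy
        ... | false rewrite cy with () ← trans (sym e) (∧-zeroʳ (S y))

      toes-not-all-in-component : ¬ (∀ j → component (t zero) (t j) ≡ true)
      toes-not-all-in-component all =
        erase-≢ {g = S} (component⊆R (S-minimal (component (t zero)) (λ _ → R⊆S ∘ component⊆R) all connected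
                                                v (body⊆S v∈A))) refl
        where
        connected : Connected G (component (t zero))
        connected = connected-via (t zero) λ y e →
          let r , p = reach-sym (component⇒reach e) in r , route-mono G p (route-in-component e p)

      component-has-toe : ∀ {p} → R p ≡ true → ¬ (∀ i → component p (t i) ≡ false)
      component-has-toe {p} rp none
        with component⊆ p (v ∷ []) (λ { (here refl) → body⊆S v∈A }) (here refl)
                        (λ { (here refl) → [] , [ ∈⇒any-≟ {w = v} {v ∷ []} (here refl) ] }) (inj₂ ∘ none)
                        (reach⇒component (reach-refl rp))
      ... | here refl = erase-≢ {g = S} rp refl

      reach-along-route : ∀ {u r} → Route G S u v r → Unique (u ∷ r) → ∀ {y} → y ∈ u ∷ r → ¬ y ≡ v → Reach u y
      reach-along-route [ _ ] _ (here refl) y≢v = ⊥-elim (y≢v refl)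
      reach-along-route {u} (_∷⟨_⟩_ {w = w} {r = r} su uw p) unique {y} y∈ y≢v = go y∈
        where
        ru : R u ≡ true
        ru = erase-true S su (λ u≡v → Unique[x∷xs]⇒x∉xs unique (subst (_∈ w ∷ r) (sym u≡v) (last∈route G p)))
        go : y ∈ u ∷ w ∷ r → Reach u y
        go (here refl) = reach-refl ru
        go (there y∈′) = let r′ , q = reach-along-route p (Unique-tail unique) y∈′ y≢v in _ , ru ∷⟨ uw ⟩ q

      -- If the component of a toe lies on a geodesic through v, the geodesic's stretch up to v
      -- only meets degree-2 vertices: each of them has no neighbours besides its flanks.
      geodesic-prefix-legPath : ∀ i {z rW ri rest} → Geodesic G S (t i) z rW → rW ≡ ri ++ rest →
                                Route G S (t i) v ri → (∀ {y} → component (t i) y ≡ true → y ∈ t i ∷ rW) →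
                                LegPath G S (t i) ri
      geodesic-prefix-legPath i {z} {rW} {ri} {rest} g refl p component⊆W =
        (route-all G p , unique , route-linked G p) , All.tabulate interior-deg2
        where
        unique : Unique (t i ∷ ri)
        unique = Unique-++⁻ˡ (t i ∷ ri) (geodesic-unique G g)
        interior-deg2 : ∀ {y} → y ∈ dropLast ri → deg G S y ≡ 2
        interior-deg2 {y} y∈ with ∈-dropLast⇒flanked (t i) ri y∈
        ... | pre , a , b , post , e =
          two-neighbours⇒deg≡2 G S (S-at a∈) (trans (adj-sym y a) ay) (S-at b∈) yb
                               (Unique-flanks-distinct pre (subst Unique e unique)) neighbours
          where
          y∈′ = ∈-dropLast-∷ (t i) ri y∈
          ay = proj₁ (Linked-flanks pre (subst (Linked _) e (route-linked G p)))
          yb = proj₂ (Linked-flanks pre (subst (Linked _) e (route-linked G p)))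
          a∈ = subst (a ∈_) (sym e) (∈-middle pre)
          b∈ = subst (b ∈_) (sym e) (∈-++⁺ʳ pre (there (there (here refl))))
          S-at : ∀ {x} → x ∈ t i ∷ ri → S x ≡ true
          S-at = route-∈ G p
          y≢v : ¬ y ≡ v
          y≢v y≡v = lastOf∉dropLast (t i) ri unique
                      (subst (_∈ dropLast (t i ∷ ri)) (trans y≡v (route-last≡lastOf G p)) y∈′)
          y-in-component : component (t i) y ≡ true
          y-in-component = reach⇒component (reach-along-route p unique (∈-dropLast⁻ (t i ∷ ri) y∈′) y≢v)
          on-W : ∀ {x} → x ∈ t i ∷ ri → x ∈ t i ∷ ri ++ rest
          on-W = ∈-++⁺ˡ
          neighbours : ∀ u → S u ≡ true → adj y u ≡ true → u ≡ a ⊎ u ≡ b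
          neighbours u su yu with u ≟ v
          ... | yes refl = geodesic-neighbour⇒flank G g pre (trans (cong (_++ rest) e) (++-assoc pre _ rest))
                                                    (on-W (last∈route G p)) yu
          ... | no u≢v  = geodesic-neighbour⇒flank G g pre (trans (cong (_++ rest) e) (++-assoc pre _ rest))
                                                    (component⊆W (component-step y-in-component (erase-true S su u≢v) yu))
                                                    yu

      component⊆route : ∀ i {z rW} → Route G S (t i) z rW → v ∈ t i ∷ rW →
                        (∀ j → t j ∈ t i ∷ rW ⊎ component (t i) (t j) ≡ false) →
                        ∀ {y} → component (t i) y ≡ true → y ∈ t i ∷ rW
      component⊆route i p v∈ toes =
        component⊆ (t i) (t i ∷ _) (route-∈ G p) v∈ (λ y∈ → route-between G p ∈⇒any-≟ y∈ v∈) toes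

      module DistancesToCut (x : Fin 4 → ℕ) (x-dist : ∀ i → Dist G S (t i) v (x i)) where

        pathToCut : Fin 4 → List (Fin n)
        pathToCut i = proj₁ (dist⇒geodesic G (x-dist i))

        geodesicToCut : ∀ i → Geodesic G S (t i) v (pathToCut i)
        geodesicToCut i = proj₁ (proj₂ (dist⇒geodesic G (x-dist i)))

        routeToCut : ∀ i → Route G S (t i) v (pathToCut i)
        routeToCut i = proj₁ (geodesicToCut i)

        pathFromCut : Fin 4 → List (Fin n)
        pathFromCut j = proj₁ (route-reverse G (routeToCut j))

        routeViaCut : ∀ i j → Route G S (t i) (t j) (pathToCut i ++ pathFromCut j)
        routeViaCut i j = route-++ G (routeToCut i) (proj₁ (proj₂ (route-reverse G (routeToCut j))))

        length-viaCut : ∀ i j → length (pathToCut i ++ pathFromCut j) ≡ x i + x j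
        length-viaCut i j = begin
          length (pathToCut i ++ pathFromCut j)       ≡⟨ length-++ (pathToCut i) ⟩
          length (pathToCut i) + length (pathFromCut j) ≡⟨ cong₂ _+_ (length-to i) length-from ⟩
          x i + x j                                    ∎
          where
          open ≡-Reasoning
          length-to : ∀ i → length (pathToCut i) ≡ x i
          length-to i = proj₂ (proj₂ (dist⇒geodesic G (x-dist i)))
          length-from : length (pathFromCut j) ≡ x j
          length-from = trans (proj₂ (proj₂ (route-reverse G (routeToCut j)))) (length-to j)

        dist≤viaCut : ∀ i j {dij} → Dist G S (t i) (t j) dij → dij ≤ x i + x j
        dist≤viaCut i j (_ , least) =
          least _ (subst (Walk G S (t i) (t j)) (length-viaCut i j) (route⇒walk G (routeViaCut i j)))

        separated⇒dist≡viaCut : ∀ i j {dij} → ¬ Reach (t i) (t j) → Dist G S (t i) (t j) dij → dij ≡ x i + x j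
        separated⇒dist≡viaCut i j {dij} unreachable dij-dist = ≤-antisym (dist≤viaCut i j dij-dist) viaCut≤dist
          where
          geodesic = dist⇒geodesic G dij-dist
          viaCut≤dist : x i + x j ≤ dij
          viaCut≤dist with route-avoids⊎meets-v (proj₁ (proj₁ (proj₂ geodesic)))
          ... | inj₁ q = ⊥-elim (unreachable (_ , q))
          ... | inj₂ (r₁ , r₂ , q₁ , q₂ , e) =
            let r₂′ , q₂′ , length-r₂′ = route-reverse G q₂ in
            subst (x i + x j ≤_) (trans e (proj₂ (proj₂ geodesic)))
                  (+-mono-≤ (proj₂ (x-dist i) _ (route⇒walk G q₁))
                            (subst (x j ≤_) length-r₂′ (proj₂ (x-dist j) _ (route⇒walk G q₂′))))

        leg≡pathToCut : ∀ i {z rest} → Geodesic G S (t i) z (pathToCut i ++ rest) →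
                        (∀ {y} → component (t i) y ≡ true → y ∈ t i ∷ pathToCut i ++ rest) → L i ≡ pathToCut i
        leg≡pathToCut i g component⊆W =
          legPath-to-body≡leg i (geodesic-prefix-legPath i g refl (routeToCut i) component⊆W)
                                (subst (λ w → A w ≡ true) (route-last≡lastOf G (routeToCut i)) v∈A)

        -- Otherwise the route through v would be a geodesic covering the component of t i, making
        -- v the joint of the i-th leg; but t i reaches t j in S − v, and can only leave its leg via the joint.
        partners⇒dist<viaCut : ∀ i j {dij} → ¬ j ≡ i → Reach (t i) (t j) →
                               (∀ k → component (t i) (t k) ≡ true → k ≡ i ⊎ k ≡ j) →
                               Dist G S (t i) (t j) dij → suc dij ≤ x i + x j
        partners⇒dist<viaCut i j {dij} j≢i (r , reach-ij) only dij-dist with suc dij ≤? x i + x j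
        ... | yes shorter = shorter
        ... | no ¬shorter = ⊥-elim (erase-≢ {g = S} (route-head G exit) joint≡v)
          where
          geodesic : Geodesic G S (t i) (t j) (pathToCut i ++ pathFromCut j)
          geodesic = routeViaCut i j , λ r′ p′ →
            ≤-trans (≤-trans (≤-reflexive (length-viaCut i j)) (≤-pred (≰⇒> ¬shorter)))
                    (proj₂ dij-dist _ (route⇒walk G p′))
          toes : ∀ k → t k ∈ t i ∷ pathToCut i ++ pathFromCut j ⊎ component (t i) (t k) ≡ false
          toes k with component (t i) (t k) in c
          ... | false = inj₂ refl
          ... | true with only k c
          ...   | inj₁ refl = inj₁ (here refl)
          ...   | inj₂ refl = inj₁ (last∈route G (routeViaCut i j))
          joint≡v : joint i ≡ v
          joint≡v = trans (cong (lastOf (t i)) (leg≡pathToCut i geodesic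
                            (component⊆route i (routeViaCut i j) (∈-++⁺ˡ (last∈route G (routeToCut i))) toes)))
                          (sym (route-last≡lastOf G (routeToCut i)))
          exit = proj₁ (proj₂ (route-exits-leg-via-joint G S (legPath i) (toe-deg≡1 i) (λ _ → R⊆S) reach-ij
                                                        (toe∈legOff i) (toe∉legOff (j≢i ∘ sym))))

        isolated-component⊆path : ∀ i → (∀ k → component (t i) (t k) ≡ true → k ≡ i) →
                                  ∀ {y} → component (t i) y ≡ true → y ∈ t i ∷ pathToCut i
        isolated-component⊆path i isolated = component⊆route i (routeToCut i) (last∈route G (routeToCut i)) toes
          where
          toes : ∀ k → t k ∈ t i ∷ pathToCut i ⊎ component (t i) (t k) ≡ false
          toes k with component (t i) (t k) in c
          ... | false = inj₂ refl
          ... | true with isolated k c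
          ...   | refl = inj₁ (here refl)

        isolated-component⊆legOff : ∀ i → (∀ k → component (t i) (t k) ≡ true → k ≡ i) →
                                    ∀ {y} → component (t i) y ≡ true → y ∈ legOff i
        isolated-component⊆legOff i isolated {y} cy
          with ∈⇒∈-dropLast⊎≡lastOf (t i) (pathToCut i) (isolated-component⊆path i isolated cy)
        ... | inj₂ y≡end =
          ⊥-elim (erase-≢ {g = S} (component⊆R cy) (trans y≡end (sym (route-last≡lastOf G (routeToCut i)))))
        ... | inj₁ y∈    = subst (λ l → y ∈ dropLast (t i ∷ l)) (sym leg≡path) y∈
          where
          path≡path++[] = sym (++-identityʳ (pathToCut i))
          leg≡path : L i ≡ pathToCut i
          leg≡path = leg≡pathToCut i (subst (Geodesic G S (t i) v) path≡path++[] (geodesicToCut i))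
                       (subst (λ l → ∀ {y} → component (t i) y ≡ true → y ∈ t i ∷ l) path≡path++[]
                              (isolated-component⊆path i isolated))

        module Separated (p q : Fin n) (p∈A′ : A′ p ≡ true) (q∈A′ : A′ q ≡ true)
                         (separated : ¬ ∃ (Walk G A′ p q)) where

          together : Fin 4 → Fin 4 → Bool
          together i j = component (t i) (t j)

          together-sym : ∀ {i j} → together i j ≡ true → together j i ≡ true
          together-sym e = reach⇒component (reach-sym (component⇒reach e))

          together-trans : ∀ {i j k} → together i j ≡ true → together j k ≡ true → together i k ≡ true
          together-trans e₁ e₂ = reach⇒component (reach-trans (component⇒reach e₁) (component⇒reach e₂))

          apart-sym : ∀ {i j} → together i j ≡ false → together j i ≡ false
          apart-sym apart = ¬-not λ ji → case trans (sym apart) (together-sym ji) of λ ()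

          open PartialPartition together together-sym together-trans

          reaches-toe : ∀ {y} → R y ≡ true → ∃ λ k → component y (t k) ≡ true
          reaches-toe {y} ry with any? (λ k → component y (t k) ≟ᵇ true)
          ... | yes found = found
          ... | no  none  = ⊥-elim (component-has-toe ry (λ k → ¬-not (λ cyk → none (k , cyk))))

          body-reaches-partnered-toe : ∀ {y} → A′ y ≡ true → ∃ λ k → component y (t k) ≡ true × Partnered k
          body-reaches-partnered-toe {y} y∈A′
            with reaches-toe (erase-true S (body⊆S (erase-⊆ {g = A} y∈A′)) (erase-≢ {g = A} y∈A′))
          ... | k , yk with partnered⊎isolated k
          ...   | inj₁ partner  = k , yk , partner
          ...   | inj₂ isolated =
            ⊥-elim (body∉legOff (erase-⊆ {g = A} y∈A′) k
                                (isolated-component⊆legOff k isolated (reach⇒component (reach-sym (component⇒reach yk)))))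

          -- An isolated toe would leave all body vertices in the components of the other toes,
          -- which are then forced into a single one: p and q would be joined in A − v.
          every-toe-partnered : ∀ i → Partnered i
          every-toe-partnered i with partnered⊎isolated i
          ... | inj₁ partner  = partner
          ... | inj₂ isolated with body-reaches-partnered-toe p∈A′ | body-reaches-partnered-toe q∈A′
          ...   | kp , pkp , (kp′ , kp′≢kp , kpkp′) | kq , qkq , (kq′ , kq′≢kq , kqkq′) =
            ⊥-elim (separated (_ , route⇒walk G (proj₂ (reroute-in-body _ ≤-refl (erase-⊆ {g = A} p∈A′)
                                                                       (erase-⊆ {g = A} q∈A′) (proj₂ p-reaches-q)))))
            where
            kp-reaches-kq : Reach (t kp) (t kq)
            kp-reaches-kq = component⇒reach (isolated⇒pairs-related isolated kp′≢kp kpkp′ kq′≢kq kqkq′)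
            p-reaches-q : Reach p q
            p-reaches-q = reach-trans (reach-trans (component⇒reach pkp) kp-reaches-kq) (reach-sym (component⇒reach qkq))

          module _ (d : Fin 4 → Fin 4 → ℕ) (d-dist : ∀ i j → Dist G S (t i) (t j) (d i j)) where

            far : ∀ i j → together i j ≡ false → d i j ≡ x i + x j
            far i j apart =
              separated⇒dist≡viaCut i j (λ r → case trans (sym (reach⇒component r)) apart of λ ()) (d-dist i j)

            near : ∀ i j → ¬ j ≡ i → together i j ≡ true → (∀ k → together i k ≡ true → k ≡ i ⊎ k ≡ j) →
                   suc (d i j) ≤ x i + x j
            near i j j≢i tij only = partners⇒dist<viaCut i j j≢i (component⇒reach tij) only (d-dist i j)

            fourPointSplit : FourPointSplit d
            fourPointSplit with every-toe-partnered 0F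
            ... | 0F , 0≢0 , _ = ⊥-elim (0≢0 refl)
            ... | 1F , _ , t01
              with two-classes 0F 1F 2F 3F enumerates toes-not-all-in-component every-toe-partnered t01
            ...   | t23 , a02 , a03 , a12 , a13 =
              inj₂ (inj₂ (pairs-through-cut-vertex (x 0F) (x 1F) (x 2F) (x 3F)
                (near 0F 1F (λ ()) t01 (class-of-pair enumerates a02 a03))
                (near 2F 3F (λ ()) t23 (class-of-pair enumerates (apart-sym a02) (apart-sym a12)))
                (far 0F 2F a02) (far 1F 3F a13) (far 0F 3F a03) (far 1F 2F a12)))
            fourPointSplit | 2F , _ , t02
              with two-classes 0F 2F 1F 3F enumerates toes-not-all-in-component every-toe-partnered t02
            ...   | t13 , a01 , a03 , a21 , a23 =
              inj₂ (inj₁ (pairs-through-cut-vertex (x 0F) (x 2F) (x 1F) (x 3F)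
                (near 0F 2F (λ ()) t02 (class-of-pair enumerates a01 a03))
                (near 1F 3F (λ ()) t13 (class-of-pair enumerates (apart-sym a01) (apart-sym a21)))
                (far 0F 1F a01) (far 2F 3F a23) (far 0F 3F a03)
                (trans (far 1F 2F (apart-sym a21)) (+-comm (x 1F) (x 2F)))))
            fourPointSplit | 3F , _ , t03
              with two-classes 0F 3F 1F 2F enumerates toes-not-all-in-component every-toe-partnered t03
            ...   | t12 , a01 , a02 , a31 , a32 =
              inj₁ (pairs-through-cut-vertex (x 0F) (x 3F) (x 1F) (x 2F)
                (near 0F 3F (λ ()) t03 (class-of-pair enumerates a01 a02))
                (near 1F 2F (λ ()) t12 (class-of-pair enumerates (apart-sym a01) (apart-sym a31)))
                (far 0F 1F a01) (trans (far 2F 3F (apart-sym a32)) (+-comm (x 2F) (x 3F))) (far 0F 2F a02)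
                (trans (far 1F 3F (apart-sym a31)) (+-comm (x 1F) (x 3F))))

¬connected⇒¬¬separated : ∀ G {X : VSet G} → ¬ Connected G X →
                         DoubleNegation (∃ λ p → ∃ λ q → X p ≡ true × X q ≡ true × ¬ ∃ (Walk G X p q))
¬connected⇒¬¬separated G {X} disconnected =
  ¬¬-Π-Fin (λ u → ¬¬-Π-Fin λ w → ¬¬-excluded-middle {A = ∃ (Walk G X u w)}) >>= λ walk? none →
  disconnected λ u w xu xw → decidable-stable (walk? u w) (λ ¬walk → none (u , w , xu , xw , ¬walk))

¬¬-distance : ∀ G {X : VSet G} {u w m} → Walk G X u w m → DoubleNegation (∃ (Dist G X u w))
¬¬-distance G {X} {u} {w} {m} = ¬¬-least (Walk G X u w) m

-- The conclusion is decidable, so it may be proved in the double-negation monad: this supplies the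
-- decisions of reachability and the least distances that the argument uses.
cut-vertex⇒fourPointSplit :
  (G : Graph) (S : VSet G) (t : Fin 4 → Fin (Graph.n G)) → IsSpider4 G S t →
  (L : Fin 4 → List (Fin (Graph.n G))) → (∀ i → IsLeg G S (t i) (L i)) →
  (∃ λ v → CutVertex G (Body G S t L) v) →
  (d : Fin 4 → Fin 4 → ℕ) → (∀ i j → Dist G S (t i) (t j) (d i j)) → FourPointSplit d
cut-vertex⇒fourPointSplit G S t spider L legs (v , v∈A , disconnected) d d-dist =
  decidable-stable (fourPointSplit? d) do
    reach? ← ¬¬-Π-Fin λ u → ¬¬-Π-Fin λ w → ¬¬-excluded-middle
    toCut  ← ¬¬-Π-Fin λ i → let _ , walk = S-connected (t i) v (toe∈S i) (body⊆S v∈A) in ¬¬-distance G walk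
    p , q , p∈A′ , q∈A′ , separated ← ¬connected⇒¬¬separated G disconnected
    return (Separated.fourPointSplit v v∈A reach? (proj₁ ∘ toCut) (proj₂ ∘ toCut)
                                     p q p∈A′ q∈A′ separated d d-dist)
  where
  open Spider G S t spider L legs
  open CutAt.Components.DistancesToCut using (module Separated)

lemma3p8 : (ℓ : ℕ) → 7 ≤ ℓ → (G : Graph) → Monoholed G ℓ
    → (S : VSet G) (t : Fin 4 → Fin (Graph.n G)) → IsSpider4 G S t
    → (L : Fin 4 → List (Fin (Graph.n G))) → (∀ i → IsLeg G S (t i) (L i))
    → (∃ λ v → CutVertex G (Body G S t L) v)
    → (d : Fin 4 → Fin 4 → ℕ) → (∀ i j → Dist G S (t i) (t j) (d i j))
    → ((d (# 0) (# 1) + d (# 2) (# 3) ≡ d (# 0) (# 2) + d (# 1) (# 3))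
         × (d (# 0) (# 3) + d (# 1) (# 2) + 2 ≤ d (# 0) (# 1) + d (# 2) (# 3)))
      ⊎ ((d (# 0) (# 1) + d (# 2) (# 3) ≡ d (# 0) (# 3) + d (# 1) (# 2))
         × (d (# 0) (# 2) + d (# 1) (# 3) + 2 ≤ d (# 0) (# 1) + d (# 2) (# 3)))
      ⊎ ((d (# 0) (# 2) + d (# 1) (# 3) ≡ d (# 0) (# 3) + d (# 1) (# 2))
         × (d (# 0) (# 1) + d (# 2) (# 3) + 2 ≤ d (# 0) (# 2) + d (# 1) (# 3)))
lemma3p8 _ _ G _ = cut-vertex⇒fourPointSplit G
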